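{- Let $A\le B$ be integers, write $D=B-A$ and $M=\max\{|A|,|B|\}$, let $d\ge 1$, and let $x_1,\ldots,x_{d+1}$ be distinct integers in $\{x\in\mathbb{Z}:A\le x\le B\}$. For $1\le i\le d+1$ let \[ Q_i = D!\,\frac{\prod_{j\neq i}(X-x_j)}{\prod_{j\neq i}(x_i-x_j)}. \] Then $Q_i\in\mathbb{Z}[X]$ and every coefficient $c$ of $Q_i$ satisfies $|c|\leq D!\,(2M)^d$. -}

module Defs where

open import Data.Nat using (ℕ; suc)
open import Data.Integer using (ℤ; _+_; _*_; _-_; -_; +_; 0ℤ; 1ℤ)
open import Data.Fin using (Fin; punchIn)
open import Data.List using (List; []; _∷_; map; foldr; tabulate)

-- Polynomials in ℤ[X] as coefficient lists, lowest degree first: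
-- a₀ ∷ a₁ ∷ … ∷ aₙ ∷ []  represents  a₀ + a₁ X + … + aₙ Xⁿ.
Poly : Set
Poly = List ℤ

polyAdd : Poly → Poly → Poly
polyAdd []       q        = q
polyAdd p        []       = p
polyAdd (a ∷ p)  (b ∷ q)  = (a + b) ∷ polyAdd p q

scale : ℤ → Poly → Poly
scale a p = map (a *_) p

polyMul : Poly → Poly → Poly
polyMul []       q = []
polyMul (a ∷ p)  q = polyAdd (scale a q) (0ℤ ∷ polyMul p q)

linX- : ℤ → Poly
linX- a = (- a) ∷ 1ℤ ∷ []

prodLin : List ℤ → Poly
prodLin = foldr (λ a p → polyMul (linX- a) p) (1ℤ ∷ [])

prodℤ : List ℤ → ℤ
prodℤ = foldr _*_ 1ℤ

others : ∀ {d} → (Fin (suc d) → ℤ) → Fin (suc d) → List ℤ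
others {d} x i = tabulate (λ (j : Fin d) → x (punchIn i j))

numer : ∀ {d} → (Fin (suc d) → ℤ) → Fin (suc d) → Poly
numer x i = prodLin (others x i)

denom : ∀ {d} → (Fin (suc d) → ℤ) → Fin (suc d) → ℤ
denom x i = prodℤ (map (λ xj → x i - xj) (others x i))

-- The quotient Q_i = D! · numer / denom is integral because the factors x_i − x_j of the
-- denominator are distinct nonzero integers in [x_i − B, x_i − A]; so they divide
-- (x_i − A)! (B − x_i)!, which divides ((x_i − A) + (B − x_i))! = D!. Its coefficients are at
-- most D! times those of ∏_{j≠i} (X − x_j), and a product of d monic linear factors with
-- constant terms bounded by M has coefficients bounded by (1 + M)^d ≤ (2M)^d; here M ≥ 1
-- because the d + 1 ≥ 2 distinct points cannot all be 0.
module Submission where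

open import Defs
open import Data.Nat using (ℕ; zero; suc; _^_; _⊔_; _!; z≤n; s≤s; NonZero)
  renaming (_*_ to _*ℕ_; _≤_ to _≤ℕ_; _+_ to _+ℕ_)
import Data.Nat.Properties as ℕ
open import Data.Nat.Divisibility using (_∣_; divides; ∣⇒≤; ∣-trans; 1∣_; *-monoʳ-∣)
open import Data.Nat.Combinatorics using (k![n∸k]!∣n!)
open import Data.Integer
  using (ℤ; _*_; _-_; _+_; -_; _≤_; +_; ∣_∣; -[1+_]; +[1+_]; +≤+; -≤-; 0ℤ; 1ℤ)
import Data.Integer.Properties as ℤ
open import Data.Integer.Tactic.RingSolver using (solve-∀)
open import Data.List using (List; []; _∷_; length; _++_; tabulate; applyDownFrom)
open import Data.List.Properties using (length-tabulate; map-tabulate)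
open import Data.List.Relation.Unary.All as All using (All; []; _∷_)
open import Data.List.Relation.Unary.All.Properties using () renaming (tabulate⁺ to All-tabulate⁺)
open import Data.List.Relation.Unary.AllPairs using (_∷_)
open import Data.List.Relation.Unary.Any using (here; there)
open import Data.List.Relation.Unary.Unique.Propositional using (Unique)
open import Data.List.Relation.Unary.Unique.Propositional.Properties using (tabulate⁺)
open import Data.List.Relation.Binary.Subset.Propositional using (_⊆_)
open import Data.List.Membership.Propositional using (_∈_)
open import Data.List.Membership.Propositional.Properties
  using (∈-∃++; ∈-++⁻; ∈-++⁺ˡ; ∈-++⁺ʳ; ∈-tabulate⁻; ∈-applyDownFrom⁺)
open import Data.Product using (∃; _×_; _,_; proj₁; proj₂)
open import Data.Sum using (inj₁; inj₂)
open import Data.Fin using (Fin; zero; suc; punchIn)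
open import Data.Fin.Properties using (punchIn-injective; punchInᵢ≢i)
open import Function.Definitions using (Injective)
open import Relation.Nullary using (¬_; contradiction)
open import Relation.Binary.PropositionalEquality
open import Algebra.Properties.AbelianGroup ℤ.+-0-abelianGroup using (∙-cancelˡ)

CoeffsBoundedBy : ℕ → Poly → Set
CoeffsBoundedBy K = All (λ c → ∣ c ∣ ≤ℕ K)

coeffsBoundedBy-mono : ∀ {K L} → K ≤ℕ L → ∀ {p} → CoeffsBoundedBy K p → CoeffsBoundedBy L p
coeffsBoundedBy-mono K≤L = All.map (λ ∣c∣≤K → ℕ.≤-trans ∣c∣≤K K≤L)

scale-coeffsBoundedBy : ∀ a {K} p → CoeffsBoundedBy K p → CoeffsBoundedBy (∣ a ∣ *ℕ K) (scale a p)
scale-coeffsBoundedBy a []      []        = []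
scale-coeffsBoundedBy a (c ∷ p) (∣c∣≤K ∷ h) =
  subst (_≤ℕ _) (sym (ℤ.abs-* a c)) (ℕ.*-monoʳ-≤ ∣ a ∣ ∣c∣≤K) ∷ scale-coeffsBoundedBy a p h

polyAdd-coeffsBoundedBy : ∀ {K L} p q → CoeffsBoundedBy K p → CoeffsBoundedBy L q →
  CoeffsBoundedBy (K +ℕ L) (polyAdd p q)
polyAdd-coeffsBoundedBy {K} {L} []      q       _          hq         =
  coeffsBoundedBy-mono (ℕ.m≤n+m L K) hq
polyAdd-coeffsBoundedBy {K} {L} (a ∷ p) []      hp         _          =
  coeffsBoundedBy-mono (ℕ.m≤m+n K L) hp
polyAdd-coeffsBoundedBy         (a ∷ p) (b ∷ q) (ha ∷ hp) (hb ∷ hq) =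
  ℕ.≤-trans (ℤ.∣i+j∣≤∣i∣+∣j∣ a b) (ℕ.+-mono-≤ ha hb) ∷ polyAdd-coeffsBoundedBy p q hp hq

-- (X − a) p = (−a) p + X p, so the bound grows by the factor ∣ a ∣ + 1.
linX-*-coeffsBoundedBy : ∀ {M K} a p → ∣ a ∣ ≤ℕ M → CoeffsBoundedBy K p →
  CoeffsBoundedBy (suc M *ℕ K) (polyMul (linX- a) p)
linX-*-coeffsBoundedBy {M} {K} a p ∣a∣≤M hp =
  coeffsBoundedBy-mono bound
    (polyAdd-coeffsBoundedBy (scale (- a) p) _
      (scale-coeffsBoundedBy (- a) p hp)
      (z≤n ∷ polyAdd-coeffsBoundedBy (scale 1ℤ p) _ (scale-coeffsBoundedBy 1ℤ p hp) (z≤n ∷ [])))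
  where
  bound : ∣ - a ∣ *ℕ K +ℕ (1 *ℕ K +ℕ 0) ≤ℕ suc M *ℕ K
  bound rewrite ℤ.∣-i∣≡∣i∣ a | ℕ.*-identityˡ K | ℕ.+-identityʳ K | ℕ.+-comm (∣ a ∣ *ℕ K) K =
    ℕ.+-monoʳ-≤ K (ℕ.*-monoˡ-≤ K ∣a∣≤M)

prodLin-coeffsBoundedBy : ∀ {M} as → All (λ a → ∣ a ∣ ≤ℕ M) as →
  CoeffsBoundedBy (suc M ^ length as) (prodLin as)
prodLin-coeffsBoundedBy []       []          = s≤s z≤n ∷ []
prodLin-coeffsBoundedBy (a ∷ as) (∣a∣≤M ∷ h) =
  linX-*-coeffsBoundedBy a (prodLin as) ∣a∣≤M (prodLin-coeffsBoundedBy as h)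

prodℤ-++ : ∀ xs ys → prodℤ (xs ++ ys) ≡ prodℤ xs * prodℤ ys
prodℤ-++ []       ys = sym (ℤ.*-identityˡ _)
prodℤ-++ (x ∷ xs) ys = trans (cong (x *_) (prodℤ-++ xs ys)) (sym (ℤ.*-assoc x _ _))

prodℤ-++-∷ : ∀ ys s zs → prodℤ (ys ++ s ∷ zs) ≡ s * prodℤ (ys ++ zs)
prodℤ-++-∷ ys s zs = begin
  prodℤ (ys ++ s ∷ zs)       ≡⟨ prodℤ-++ ys (s ∷ zs) ⟩
  prodℤ ys * (s * prodℤ zs)  ≡⟨ swap (prodℤ ys) s (prodℤ zs) ⟩
  s * (prodℤ ys * prodℤ zs)  ≡⟨ cong (s *_) (prodℤ-++ ys zs) ⟨
  s * prodℤ (ys ++ zs)       ∎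
  where
  open ≡-Reasoning
  swap : ∀ a b c → a * (b * c) ≡ b * (a * c)
  swap = solve-∀

∈-++-∷⁻ : ∀ {t s : ℤ} ys zs → t ∈ ys ++ s ∷ zs → ¬ t ≡ s → t ∈ ys ++ zs
∈-++-∷⁻ ys zs t∈ t≢s with ∈-++⁻ ys t∈
... | inj₁ t∈ys         = ∈-++⁺ˡ t∈ys
... | inj₂ (here t≡s)   = contradiction t≡s t≢s
... | inj₂ (there t∈zs) = ∈-++⁺ʳ ys t∈zs

∣prodℤ∣-∣-⊆ : ∀ {S T} → Unique S → S ⊆ T → ∣ prodℤ S ∣ ∣ ∣ prodℤ T ∣
∣prodℤ∣-∣-⊆ {[]}    _          _    = 1∣ _
∣prodℤ∣-∣-⊆ {s ∷ S} (s∉S ∷ uS) S⊆T with ∈-∃++ (S⊆T (here refl))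
... | ys , zs , refl =
  subst₂ _∣_ (sym (ℤ.abs-* s (prodℤ S)))
             (trans (sym (ℤ.abs-* s _)) (cong ∣_∣ (sym (prodℤ-++-∷ ys s zs))))
    (*-monoʳ-∣ ∣ s ∣ (∣prodℤ∣-∣-⊆ uS S⊆ys++zs))
  where
  S⊆ys++zs : S ⊆ ys ++ zs
  S⊆ys++zs t∈S = ∈-++-∷⁻ ys zs (S⊆T (there t∈S)) (λ t≡s → All.lookup s∉S t∈S (sym t≡s))

∣prodℤ-applyDownFrom∣ : ∀ (f : ℕ → ℤ) → (∀ k → ∣ f k ∣ ≡ suc k) →
  ∀ n → ∣ prodℤ (applyDownFrom f n) ∣ ≡ n !
∣prodℤ-applyDownFrom∣ f ∣f∣ zero    = refl
∣prodℤ-applyDownFrom∣ f ∣f∣ (suc n) = begin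
  ∣ f n * prodℤ (applyDownFrom f n) ∣        ≡⟨ ℤ.abs-* (f n) _ ⟩
  ∣ f n ∣ *ℕ ∣ prodℤ (applyDownFrom f n) ∣   ≡⟨ cong₂ _*ℕ_ (∣f∣ n) (∣prodℤ-applyDownFrom∣ f ∣f∣ n) ⟩
  suc n !                                    ∎
  where open ≡-Reasoning

nonzerosIn : ℕ → ℕ → List ℤ
nonzerosIn a b = applyDownFrom +[1+_] a ++ applyDownFrom -[1+_] b

∣prodℤ-nonzerosIn∣ : ∀ a b → ∣ prodℤ (nonzerosIn a b) ∣ ≡ a ! *ℕ b !
∣prodℤ-nonzerosIn∣ a b = begin
  ∣ prodℤ (nonzerosIn a b) ∣                    ≡⟨ cong ∣_∣ (prodℤ-++ positives negatives) ⟩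
  ∣ prodℤ positives * prodℤ negatives ∣         ≡⟨ ℤ.abs-* (prodℤ positives) _ ⟩
  ∣ prodℤ positives ∣ *ℕ ∣ prodℤ negatives ∣    ≡⟨ cong₂ _*ℕ_ (∣prodℤ-applyDownFrom∣ +[1+_] (λ _ → refl) a)
                                                                (∣prodℤ-applyDownFrom∣ -[1+_] (λ _ → refl) b) ⟩
  a ! *ℕ b !                                    ∎
  where
  open ≡-Reasoning
  positives negatives : List ℤ
  positives = applyDownFrom +[1+_] a
  negatives = applyDownFrom -[1+_] b

∈-nonzerosIn : ∀ {a b t} → ¬ t ≡ 0ℤ → - (+ b) ≤ t → t ≤ + a → t ∈ nonzerosIn a b
∈-nonzerosIn {t = + zero}   t≢0 _    _    = contradiction refl t≢0
∈-nonzerosIn {t = +[1+ n ]} _   _    t≤a  = ∈-++⁺ˡ (∈-applyDownFrom⁺ +[1+_] (ℤ.drop‿+≤+ t≤a))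
∈-nonzerosIn {a} {t = -[1+ n ]} _ -b≤t _ =
  ∈-++⁺ʳ (applyDownFrom +[1+_] a) (∈-applyDownFrom⁺ -[1+_] (ℤ.drop‿+≤+ (ℤ.neg-cancel-≤ -b≤t)))

unique-nonzerosIn⇒∣prodℤ∣∣a!b! : ∀ {S a b} → Unique S → S ⊆ nonzerosIn a b →
  ∣ prodℤ S ∣ ∣ a ! *ℕ b !
unique-nonzerosIn⇒∣prodℤ∣∣a!b! {a = a} {b} uS S⊆ =
  subst (_ ∣_) (∣prodℤ-nonzerosIn∣ a b) (∣prodℤ∣-∣-⊆ uS S⊆)

a!b!∣[a+b]! : ∀ a b → a ! *ℕ b ! ∣ (a +ℕ b) !
a!b!∣[a+b]! a b =
  subst (λ m → a ! *ℕ m ! ∣ (a +ℕ b) !) (ℕ.m+n∸m≡n a b) (k![n∸k]!∣n! (ℕ.m≤m+n a b))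

∣∣≤∣lower∣⊔∣upper∣ : ∀ {A B y} → A ≤ y → y ≤ B → ∣ y ∣ ≤ℕ ∣ A ∣ ⊔ ∣ B ∣
∣∣≤∣lower∣⊔∣upper∣ {A} {+ m}      {+ n}      _           (+≤+ n≤m) = ℕ.≤-trans n≤m (ℕ.m≤n⊔m ∣ A ∣ m)
∣∣≤∣lower∣⊔∣upper∣ { -[1+ m ]} {B} { -[1+ n ]} (-≤- n≤m) _         = ℕ.m≤n⇒m≤n⊔o ∣ B ∣ (s≤s n≤m)

+∣j-i∣≡j-i : ∀ {i j} → i ≤ j → + ∣ j - i ∣ ≡ j - i
+∣j-i∣≡j-i i≤j = ℤ.0≤i⇒+∣i∣≡i (ℤ.i≤j⇒0≤j-i i≤j)

∣y-A∣+∣B-y∣≡∣B-A∣ : ∀ {A B y} → A ≤ y → y ≤ B → ∣ y - A ∣ +ℕ ∣ B - y ∣ ≡ ∣ B - A ∣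
∣y-A∣+∣B-y∣≡∣B-A∣ {A} {B} {y} A≤y y≤B = begin
  ∣ y - A ∣ +ℕ ∣ B - y ∣            ≡⟨ cong ∣_∣ (ℤ.pos-+ ∣ y - A ∣ ∣ B - y ∣) ⟩
  ∣ + ∣ y - A ∣ + + ∣ B - y ∣ ∣     ≡⟨ cong₂ (λ u v → ∣ u + v ∣) (+∣j-i∣≡j-i A≤y) (+∣j-i∣≡j-i y≤B) ⟩
  ∣ (y - A) + (B - y) ∣             ≡⟨ cong ∣_∣ (telescope A B y) ⟩
  ∣ B - A ∣                         ∎
  where
  open ≡-Reasoning
  telescope : ∀ A B y → (y - A) + (B - y) ≡ B - A
  telescope = solve-∀

y-z∈nonzerosIn : ∀ {A B y z} → A ≤ y → y ≤ B → A ≤ z → z ≤ B → ¬ z ≡ y →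
  y - z ∈ nonzerosIn ∣ y - A ∣ ∣ B - y ∣
y-z∈nonzerosIn {A} {B} {y} {z} A≤y y≤B A≤z z≤B z≢y =
  ∈-nonzerosIn y-z≢0 lower upper
  where
  y-z≢0 : ¬ y - z ≡ 0ℤ
  y-z≢0 y-z≡0 = z≢y (sym (ℤ.i-j≡0⇒i≡j y z y-z≡0))
  upper : y - z ≤ + ∣ y - A ∣
  upper = subst (y - z ≤_) (sym (+∣j-i∣≡j-i A≤y)) (ℤ.+-monoʳ-≤ y (ℤ.neg-mono-≤ A≤z))
  lower : - (+ ∣ B - y ∣) ≤ y - z
  lower = subst (_≤ y - z) (trans (negate-diff y B) (cong -_ (sym (+∣j-i∣≡j-i y≤B))))
                (ℤ.+-monoʳ-≤ y (ℤ.neg-mono-≤ z≤B))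
    where
    negate-diff : ∀ y B → y - B ≡ - (B - y)
    negate-diff = solve-∀

denom≡prodℤ-tabulate : ∀ {d} (x : Fin (suc d) → ℤ) i →
  denom x i ≡ prodℤ (tabulate (λ j → x i - x (punchIn i j)))
denom≡prodℤ-tabulate x i = cong prodℤ (map-tabulate (λ j → x (punchIn i j)) (λ xj → x i - xj))

∣denom∣∣∣B-A∣! : ∀ {A B d} (x : Fin (suc d) → ℤ) → Injective _≡_ _≡_ x →
  (∀ k → A ≤ x k × x k ≤ B) → ∀ i → ∣ denom x i ∣ ∣ ∣ B - A ∣ !
∣denom∣∣∣B-A∣! {A} {B} x x-inj x∈[A,B] i =
  ∣-trans (subst (λ p → ∣ p ∣ ∣ a ! *ℕ b !) (sym (denom≡prodℤ-tabulate x i))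
                 (unique-nonzerosIn⇒∣prodℤ∣∣a!b! {a = a} {b} (tabulate⁺ differences-injective) differences⊆))
          (subst (λ n → a ! *ℕ b ! ∣ n !) (∣y-A∣+∣B-y∣≡∣B-A∣ A≤xi xi≤B) (a!b!∣[a+b]! a b))
  where
  a b : ℕ
  a = ∣ x i - A ∣
  b = ∣ B - x i ∣
  A≤xi : A ≤ x i
  A≤xi = proj₁ (x∈[A,B] i)
  xi≤B : x i ≤ B
  xi≤B = proj₂ (x∈[A,B] i)
  differences-injective : ∀ {j k} → x i - x (punchIn i j) ≡ x i - x (punchIn i k) → j ≡ k
  differences-injective e = punchIn-injective i _ _ (x-inj (ℤ.neg-injective (∙-cancelˡ (x i) _ _ e)))
  differences⊆ : tabulate (λ j → x i - x (punchIn i j)) ⊆ nonzerosIn a b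
  differences⊆ t∈ with ∈-tabulate⁻ t∈
  ... | j , refl = y-z∈nonzerosIn A≤xi xi≤B (proj₁ (x∈[A,B] (punchIn i j))) (proj₂ (x∈[A,B] (punchIn i j)))
                                  (λ e → punchInᵢ≢i i j (x-inj e))

∣∣-∣⇒∃quotient : ∀ (m : ℤ) n → .{{_ : NonZero n}} → ∣ m ∣ ∣ n →
  ∃ λ q → q * m ≡ + n × ∣ q ∣ ≤ℕ n
∣∣-∣⇒∃quotient (+ m)      n (divides k n≡km) =
  + k , trans (sym (ℤ.pos-* k m)) (cong +_ (sym n≡km)) , ∣⇒≤ (divides m (trans n≡km (ℕ.*-comm k m)))
∣∣-∣⇒∃quotient -[1+ m ]  n (divides k n≡km) =
  - (+ k) , trans (neg*neg (+ k) +[1+ m ]) (trans (sym (ℤ.pos-* k (suc m))) (cong +_ (sym n≡km))) ,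
  subst (_≤ℕ n) (sym (ℤ.∣-i∣≡∣i∣ (+ k))) (∣⇒≤ (divides (suc m) (trans n≡km (ℕ.*-comm k (suc m)))))
  where
  neg*neg : ∀ a b → - a * - b ≡ a * b
  neg*neg = solve-∀

distinct⇒1≤bound : ∀ {M} {u v : ℤ} → ¬ u ≡ v → ∣ u ∣ ≤ℕ M → ∣ v ∣ ≤ℕ M → 1 ≤ℕ M
distinct⇒1≤bound {zero}  u≢v ∣u∣≤0 ∣v∣≤0 =
  contradiction (trans (ℤ.∣i∣≡0⇒i≡0 (ℕ.n≤0⇒n≡0 ∣u∣≤0)) (sym (ℤ.∣i∣≡0⇒i≡0 (ℕ.n≤0⇒n≡0 ∣v∣≤0)))) u≢v
distinct⇒1≤bound {suc M} _ _ _ = s≤s z≤n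

numer-coeffsBoundedBy : ∀ {d M} (x : Fin (suc d) → ℤ) i → (∀ k → ∣ x k ∣ ≤ℕ M) →
  CoeffsBoundedBy (suc M ^ d) (numer x i)
numer-coeffsBoundedBy {M = M} x i ∣x∣≤M =
  subst (λ n → CoeffsBoundedBy (suc M ^ n) (numer x i)) (length-tabulate (λ j → x (punchIn i j)))
    (prodLin-coeffsBoundedBy (others x i) (All-tabulate⁺ (λ j → ∣x∣≤M (punchIn i j))))

1+n≤2n : ∀ {n} → 1 ≤ℕ n → suc n ≤ℕ 2 *ℕ n
1+n≤2n {n} 1≤n rewrite ℕ.+-identityʳ n = ℕ.+-monoˡ-≤ n 1≤n

lemma3p1 : (A B : ℤ) → A ≤ B → (d : ℕ) → 1 ≤ℕ d →
    (x : Fin (suc d) → ℤ) → Injective _≡_ _≡_ x →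
    (∀ k → A ≤ x k × x k ≤ B) →
    (i : Fin (suc d)) →
    ∀ c → c ∈ numer x i →
    ∃ λ (q : ℤ) → (q * denom x i ≡ (+ (∣ B - A ∣ !)) * c)
    × ∣ q ∣ ≤ℕ (∣ B - A ∣ !) *ℕ ((2 *ℕ (∣ A ∣ ⊔ ∣ B ∣)) ^ d)
lemma3p1 A B _ (suc d) _ x x-inj x∈[A,B] i c c∈numer
  with ∣∣-∣⇒∃quotient (denom x i) (∣ B - A ∣ !) {{∣ B - A ∣ ℕ.!≢0}} (∣denom∣∣∣B-A∣! x x-inj x∈[A,B] i)
... | e , e*denom≡D! , ∣e∣≤D! =
  e * c ,
  trans (rearrange e c (denom x i)) (cong (_* c) e*denom≡D!) ,
  subst (_≤ℕ _) (sym (ℤ.abs-* e c)) (ℕ.*-mono-≤ ∣e∣≤D! ∣c∣≤[2M]^d)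
  where
  M : ℕ
  M = ∣ A ∣ ⊔ ∣ B ∣
  rearrange : ∀ e c den → (e * c) * den ≡ (e * den) * c
  rearrange = solve-∀
  ∣x∣≤M : ∀ k → ∣ x k ∣ ≤ℕ M
  ∣x∣≤M k = ∣∣≤∣lower∣⊔∣upper∣ (proj₁ (x∈[A,B] k)) (proj₂ (x∈[A,B] k))
  1≤M : 1 ≤ℕ M
  1≤M = distinct⇒1≤bound (λ e → contradiction (x-inj e) λ ()) (∣x∣≤M zero) (∣x∣≤M (suc zero))
  ∣c∣≤[2M]^d : ∣ c ∣ ≤ℕ (2 *ℕ M) ^ suc d
  ∣c∣≤[2M]^d = ℕ.≤-trans (All.lookup (numer-coeffsBoundedBy x i ∣x∣≤M) c∈numer)
                         (ℕ.^-monoˡ-≤ (suc d) (1+n≤2n 1≤M))
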